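{- Let $G_1$ and $G_2$ be simple connected graphs, each with at least one edge, and let $G=G_1\oplus_v G_2$ be their 1-sum, in which a vertex of $G_1$ and a vertex of $G_2$ are identified into the single vertex $v$. Let $m_1=|E(G_1)|$, $m_2=|E(G_2)|$, so that $|E(G)|=m_1+m_2$. Then $$\mathscr{K}(G)=\frac{m_1\left(\mathscr{K}(G_1)+\mu(G_2,v)\right)+m_2\left(\mathscr{K}(G_2)+\mu(G_1,v)\right)}{m_1+m_2}.$$
   Context: All graphs are finite, simple, undirected. For a connected graph $H$ with Laplacian $L$, the effective resistance between vertices $i,j$ is $r_H(i,j)=(e_i-e_j)^TL^\dagger(e_i-e_j)$, where $L^\dagger$ is the Moore–Penrose pseudoinverse and $e_i$ the $i$-th standard basis vector (equivalently, the resistance between $i$ and $j$ when each edge is a unit resistor). For a connected graph $H$ with $m\ge1$ edges and degrees $d_i$, Kemeny's constant is $\mathscr{K}(H)=\sum_j \pi_j m_{ij}$ for the simple random walk on $H$, where $\pi_j=d_j/(2m)$ and $m_{ij}$ is the expected hitting time of $j$ from $i$ (with $m_{jj}=0$); it equals $\frac{1}{4m}\sum_{i,j\in V(H)} d_id_j r_H(i,j)$. The moment of a vertex $v$ of $H$ is $\mu(H,v)=\sum_{i\in V(H)} d_i\, r_H(i,v)$. The 1-sum $G_1\oplus_{v_1,v_2}G_2$ of graphs $G_1,G_2$ at vertices $v_1\in V(G_1)$, $v_2\in V(G_2)$ is obtained from the disjoint union of $G_1$ and $G_2$ by identifying $v_1$ and $v_2$ into a single vertex $v$; in $\mu(G_1,v)$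 and $\mu(G_2,v)$, $v$ denotes this vertex viewed in $G_1$ resp. $G_2$. -}

module Defs where

open import Data.Bool using (Bool; true; false; if_then_else_; _∨_; _∧_)
open import Data.Nat as ℕ using (ℕ; zero; suc)
open import Data.Fin using (Fin; zero; suc; splitAt; punchIn; _≟_)
open import Data.Sum using (_⊎_; inj₁; inj₂)
open import Data.Product using (Σ; ∃; _×_; _,_)
open import Relation.Nullary using (yes; no; ¬_; does)
open import Relation.Binary.PropositionalEquality using (_≡_; refl)
open import Data.Rational as ℚ using (ℚ; 0ℚ; 1ℚ; _+_; _*_; _-_; 1/_)
import Data.Rational.Properties as ℚP

Adj : ℕ → Set
Adj n = Fin n → Fin n → Bool

Simple : ∀ {n} → Adj n → Set
Simple {n} A = (∀ i j → A i j ≡ A j i) × (∀ i → A i i ≡ false)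

data Reach {n} (A : Adj n) (i : Fin n) : Fin n → Set where
  here : Reach A i i
  step : ∀ {j k} → Reach A i j → A j k ≡ true → Reach A i k

Connected : ∀ {n} → Adj n → Set
Connected {n} A = ∀ i j → Reach A i j

HasEdge : ∀ {n} → Adj n → Set
HasEdge {n} A = ∃ λ i → ∃ λ j → A i j ≡ true

Σ[_] : ∀ n → (Fin n → ℚ) → ℚ
Σ[ zero ] f = 0ℚ
Σ[ suc n ] f = f zero + Σ[ n ] (λ i → f (suc i))

b2q : Bool → ℚ
b2q true = 1ℚ
b2q false = 0ℚ

δ : ∀ {n} → Fin n → Fin n → ℚ
δ i j = b2q (does (i ≟ j))

deg : ∀ {n} → Adj n → Fin n → ℚ
deg {n} A i = Σ[ n ] (λ j → b2q (A i j))

edges : ∀ {n} → Adj n → ℚ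
edges {n} A = ℚ.½ * Σ[ n ] (deg A)

Mat : ℕ → Set
Mat n = Fin n → Fin n → ℚ

_⊗_ : ∀ {n} → Mat n → Mat n → Mat n
_⊗_ {n} M N i j = Σ[ n ] (λ k → M i k * N k j)

transpose : ∀ {n} → Mat n → Mat n
transpose M i j = M j i

laplacian : ∀ {n} → Adj n → Mat n
laplacian A i j = δ i j * deg A i - b2q (A i j)

-- X is the Moore–Penrose pseudoinverse of L (Penrose equations; real matrices,
-- so conjugate transpose = transpose)
IsPinv : ∀ {n} → Mat n → Mat n → Set
IsPinv L X = ((L ⊗ X) ⊗ L ≡ L) × ((X ⊗ L) ⊗ X ≡ X)
           × (transpose (L ⊗ X) ≡ L ⊗ X) × (transpose (X ⊗ L) ≡ X ⊗ L)

resistance : ∀ {n} → Mat n → Fin n → Fin n → ℚ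
resistance {n} X i j =
  Σ[ n ] (λ a → Σ[ n ] (λ b → (δ i a - δ j a) * X a b * (δ i b - δ j b)))

-- total inverse on ℚ (1/q for q ≠ 0; only used with q ≠ 0)
inv : ℚ → ℚ
inv q with q ℚP.≟ 0ℚ
... | yes _ = 0ℚ
... | no q≢0 = (1/ q) {{ℚ.≢-nonZero q≢0}}

kemeny : ∀ {n} → Adj n → Mat n → ℚ
kemeny {n} A X = inv ((1ℚ + 1ℚ + 1ℚ + 1ℚ) * edges A) *
  Σ[ n ] (λ i → Σ[ n ] (λ j → deg A i * deg A j * resistance X i j))

moment : ∀ {n} → Adj n → Mat n → Fin n → ℚ
moment {n} A X v = Σ[ n ] (λ i → deg A i * resistance X i v)

-- 1-sum G1 ⊕_{v1,v2} G2.  Vertices of G1 are 0..n1-1 (kept as is); the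
-- vertices of G2 other than v2 become n1, n1+1, ... (via punchIn v2), and
-- v2 is identified with v1.
oneSum : ∀ {n1 k2} → Adj n1 → Adj (suc k2) → Fin n1 → Fin (suc k2)
       → Adj (n1 ℕ.+ k2)
oneSum {n1} {k2} A1 A2 v1 v2 x y = go (splitAt n1 x) (splitAt n1 y)
  where
    go : Fin n1 ⊎ Fin k2 → Fin n1 ⊎ Fin k2 → Bool
    go (inj₁ i) (inj₁ j) = A1 i j
    go (inj₂ p) (inj₂ q) = A2 (punchIn v2 p) (punchIn v2 q)
    go (inj₁ i) (inj₂ q) = does (i ≟ v1) ∧ A2 v2 (punchIn v2 q)
    go (inj₂ p) (inj₁ j) = does (j ≟ v1) ∧ A2 (punchIn v2 p) v2

module Submission where

-- Effective resistance is additive across a cut vertex: r_G(i,j) is r_{G₁}(i,j) or r_{G₂}(i,j) when i, j lie on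
-- the same side, and r_{G₁}(i,v) + r_{G₂}(v,j) otherwise. To see this, read r(i,j) off as y_i − y_j for any
-- potential y with L y = e_i − e_j (one exists since ker L consists of the constants on a connected graph), and
-- glue potentials of G₁ and G₂ that vanish at v into one of G. Vertex degrees in G are those in G₁ and G₂, with v
-- carrying both, so splitting 4m·K(G) = Σ_{i,j} d_i d_j r(i,j) into the four blocks of vertex pairs gives
-- 4m₁K(G₁) + 4m₂K(G₂) + 4(m₁μ(G₂,v) + m₂μ(G₁,v)).

open import Defs
open import Data.Bool using (true; false; _∧_)
open import Data.Empty using (⊥-elim)
open import Data.Fin using (Fin; zero; suc; _≟_; punchIn; punchOut; _↑ˡ_; _↑ʳ_; splitAt; join)
import Data.Fin.Properties as Finₚ
open import Data.Nat as ℕ using (ℕ; zero; suc)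
open import Data.Product using (_,_; proj₁; proj₂)
open import Data.Rational as ℚ using (ℚ; 0ℚ; 1ℚ; ½; _+_; _*_; _-_; -_; _≤_)
open import Data.Rational.Properties hiding (_≟_)
open import Data.Rational.Solver
open import Data.Sum using (inj₁; inj₂; _⊎_; [_,_]′)
open import Relation.Binary.PropositionalEquality
open import Relation.Nullary using (yes; no; does; Dec)

open +-*-Solver
open ≡-Reasoning

-- Finite sums

Σ-cong : ∀ n {f g : Fin n → ℚ} → (∀ i → f i ≡ g i) → Σ[ n ] f ≡ Σ[ n ] g
Σ-cong zero    f≗g = refl
Σ-cong (suc n) f≗g = cong₂ _+_ (f≗g zero) (Σ-cong n (λ i → f≗g (suc i)))

Σ-≡0 : ∀ n {f : Fin n → ℚ} → (∀ i → f i ≡ 0ℚ) → Σ[ n ] f ≡ 0ℚ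
Σ-≡0 zero    f≗0 = refl
Σ-≡0 (suc n) f≗0 =
  trans (cong₂ _+_ (f≗0 zero) (Σ-≡0 n (λ i → f≗0 (suc i)))) (+-identityˡ 0ℚ)

Σ-+ : ∀ n (f g : Fin n → ℚ) → Σ[ n ] (λ i → f i + g i) ≡ Σ[ n ] f + Σ[ n ] g
Σ-+ zero    f g = sym (+-identityˡ 0ℚ)
Σ-+ (suc n) f g =
  trans (cong (f zero + g zero +_) (Σ-+ n (λ i → f (suc i)) (λ i → g (suc i))))
        (+-interchange (f zero) (g zero) _ _)
  where
  +-interchange : ∀ a b c d → (a + b) + (c + d) ≡ (a + c) + (b + d)
  +-interchange = solve 4 (λ a b c d → (a :+ b) :+ (c :+ d) := (a :+ c) :+ (b :+ d)) refl

Σ-*ˡ : ∀ n c (f : Fin n → ℚ) → c * Σ[ n ] f ≡ Σ[ n ] (λ i → c * f i)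
Σ-*ˡ zero    c f = *-zeroʳ c
Σ-*ˡ (suc n) c f =
  trans (*-distribˡ-+ c (f zero) _) (cong (c * f zero +_) (Σ-*ˡ n c (λ i → f (suc i))))

Σ-*ʳ : ∀ n c (f : Fin n → ℚ) → Σ[ n ] f * c ≡ Σ[ n ] (λ i → f i * c)
Σ-*ʳ n c f =
  trans (*-comm _ c) (trans (Σ-*ˡ n c f) (Σ-cong n (λ i → *-comm c (f i))))

Σ-neg : ∀ n (f : Fin n → ℚ) → Σ[ n ] (λ i → - f i) ≡ - Σ[ n ] f
Σ-neg n f = begin
  Σ[ n ] (λ i → - f i)        ≡⟨ Σ-cong n (λ i → sym (-1*x≡-x (f i))) ⟩
  Σ[ n ] (λ i → - 1ℚ * f i)   ≡⟨ sym (Σ-*ˡ n (- 1ℚ) f) ⟩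
  - 1ℚ * Σ[ n ] f             ≡⟨ -1*x≡-x (Σ[ n ] f) ⟩
  - Σ[ n ] f                  ∎
  where
  -1*x≡-x : ∀ x → - 1ℚ * x ≡ - x
  -1*x≡-x = solve 1 (λ x → :- con 1ℚ :* x := :- x) refl

Σ-sub : ∀ n (f g : Fin n → ℚ) → Σ[ n ] (λ i → f i - g i) ≡ Σ[ n ] f - Σ[ n ] g
Σ-sub n f g = trans (Σ-+ n f (λ i → - g i)) (cong (Σ[ n ] f +_) (Σ-neg n g))

Σ-swap : ∀ n m (f : Fin n → Fin m → ℚ) →
         Σ[ n ] (λ i → Σ[ m ] (f i)) ≡ Σ[ m ] (λ j → Σ[ n ] (λ i → f i j))
Σ-swap zero    m f = sym (Σ-≡0 m (λ _ → refl))
Σ-swap (suc n) m f =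
  trans (cong (Σ[ m ] (f zero) +_) (Σ-swap n m (λ i → f (suc i)))) (sym (Σ-+ m _ _))

Σ-↑ : ∀ m n (f : Fin (m ℕ.+ n) → ℚ) →
      Σ[ m ℕ.+ n ] f ≡ Σ[ m ] (λ i → f (i ↑ˡ n)) + Σ[ n ] (λ p → f (m ↑ʳ p))
Σ-↑ zero    n f = sym (+-identityˡ _)
Σ-↑ (suc m) n f =
  trans (cong (f zero +_) (Σ-↑ m n (λ i → f (suc i)))) (sym (+-assoc (f zero) _ _))

Σ-punchIn : ∀ k (v : Fin (suc k)) (f : Fin (suc k) → ℚ) →
            Σ[ suc k ] f ≡ f v + Σ[ k ] (λ p → f (punchIn v p))
Σ-punchIn k       zero    f = refl
Σ-punchIn (suc k) (suc v) f =
  trans (cong (f zero +_) (Σ-punchIn k v (λ i → f (suc i)))) (x+[y+z]≡y+[x+z] (f zero) (f (suc v)) _)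
  where
  x+[y+z]≡y+[x+z] : ∀ x y z → x + (y + z) ≡ y + (x + z)
  x+[y+z]≡y+[x+z] = solve 3 (λ x y z → x :+ (y :+ z) := y :+ (x :+ z)) refl

Σ-*-+ʳ : ∀ n (w f : Fin n → ℚ) t →
         Σ[ n ] (λ i → w i * (f i + t)) ≡ Σ[ n ] (λ i → w i * f i) + Σ[ n ] w * t
Σ-*-+ʳ n w f t = trans (Σ-cong n (λ i → *-distribˡ-+ (w i) (f i) t))
  (trans (Σ-+ n _ _) (cong (Σ[ n ] (λ i → w i * f i) +_) (sym (Σ-*ʳ n t w))))

Σ-*-affine : ∀ n (w f g : Fin n → ℚ) t s →
  Σ[ n ] (λ i → w i * (f i + (t + s * g i)))
  ≡ Σ[ n ] (λ i → w i * f i) + (Σ[ n ] w * t + s * Σ[ n ] (λ i → w i * g i))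
Σ-*-affine n w f g t s = begin
  Σ[ n ] (λ i → w i * (f i + (t + s * g i)))
    ≡⟨ Σ-cong n (λ i → expand (w i) (f i) (g i) t s) ⟩
  Σ[ n ] (λ i → w i * f i + (w i * t + s * (w i * g i)))
    ≡⟨ trans (Σ-+ n _ _) (cong (Σ[ n ] (λ i → w i * f i) +_) (Σ-+ n _ _)) ⟩
  Σ[ n ] (λ i → w i * f i) + (Σ[ n ] (λ i → w i * t) + Σ[ n ] (λ i → s * (w i * g i)))
    ≡⟨ cong (Σ[ n ] (λ i → w i * f i) +_) (cong₂ _+_ (sym (Σ-*ʳ n t w)) (sym (Σ-*ˡ n s _))) ⟩
  Σ[ n ] (λ i → w i * f i) + (Σ[ n ] w * t + s * Σ[ n ] (λ i → w i * g i)) ∎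
  where
  expand : ∀ w f g t s → w * (f + (t + s * g)) ≡ w * f + (w * t + s * (w * g))
  expand = solve 5 (λ w f g t s → w :* (f :+ (t :+ s :* g)) := w :* f :+ (w :* t :+ s :* (w :* g))) refl

δ-refl : ∀ {n} (i : Fin n) → δ i i ≡ 1ℚ
δ-refl i with i ≟ i
... | yes _  = refl
... | no i≢i = ⊥-elim (i≢i refl)

δ-≢ : ∀ {n} {i j : Fin n} → i ≢ j → δ i j ≡ 0ℚ
δ-≢ {i = i} {j} i≢j with i ≟ j
... | yes i≡j = ⊥-elim (i≢j i≡j)
... | no _    = refl

δ-sym : ∀ {n} (i j : Fin n) → δ i j ≡ δ j i
δ-sym i j with i ≟ j | j ≟ i
... | yes _   | yes _   = refl
... | no _    | no _    = refl
... | yes i≡j | no j≢i  = ⊥-elim (j≢i (sym i≡j))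
... | no i≢j  | yes j≡i = ⊥-elim (i≢j (sym j≡i))

δ-injective : ∀ {n m} (f : Fin n → Fin m) → (∀ a b → f a ≡ f b → a ≡ b) →
              ∀ a b → δ (f a) (f b) ≡ δ a b
δ-injective f f-inj a b with a ≟ b
... | yes refl = δ-refl (f a)
... | no a≢b   = δ-≢ (λ fa≡fb → a≢b (f-inj a b fa≡fb))

δ-*-cong : ∀ {n} (i j : Fin n) (F : ℚ → ℚ) {u u′} → (i ≡ j → u ≡ u′) →
           δ i j * F u ≡ δ i j * F u′
δ-*-cong i j F {u} {u′} u≡u′ with i ≟ j
... | yes i≡j = cong (λ t → 1ℚ * F t) (u≡u′ i≡j)
... | no _    = trans (*-zeroˡ (F u)) (sym (*-zeroˡ (F u′)))

Σ-δˡ : ∀ n (i : Fin n) (f : Fin n → ℚ) → Σ[ n ] (λ j → δ i j * f j) ≡ f i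
Σ-δˡ (suc n) i f = begin
  Σ[ suc n ] (λ j → δ i j * f j)
    ≡⟨ Σ-punchIn n i (λ j → δ i j * f j) ⟩
  δ i i * f i + Σ[ n ] (λ p → δ i (punchIn i p) * f (punchIn i p))
    ≡⟨ cong₂ _+_ (cong (_* f i) (δ-refl i)) (Σ-≡0 n off-diagonal) ⟩
  1ℚ * f i + 0ℚ
    ≡⟨ trans (+-identityʳ _) (*-identityˡ _) ⟩
  f i ∎
  where
  off-diagonal : ∀ p → δ i (punchIn i p) * f (punchIn i p) ≡ 0ℚ
  off-diagonal p = trans (cong (_* f (punchIn i p)) (δ-≢ (λ i≡ → Finₚ.punchInᵢ≢i i p (sym i≡))))
                         (*-zeroˡ (f (punchIn i p)))

Σ-δʳ : ∀ n (i : Fin n) (f : Fin n → ℚ) → Σ[ n ] (λ j → f j * δ i j) ≡ f i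
Σ-δʳ n i f = trans (Σ-cong n (λ j → *-comm (f j) (δ i j))) (Σ-δˡ n i f)

Σ-δˡ′ : ∀ n (i : Fin n) (f : Fin n → ℚ) → Σ[ n ] (λ j → δ j i * f j) ≡ f i
Σ-δˡ′ n i f = trans (Σ-cong n (λ j → cong (_* f j) (δ-sym j i))) (Σ-δˡ n i f)

b2q-∧ : ∀ a b → b2q (a ∧ b) ≡ b2q a * b2q b
b2q-∧ true  b = sym (*-identityˡ _)
b2q-∧ false b = sym (*-zeroˡ (b2q b))

b2q-nonNeg : ∀ b → 0ℚ ≤ b2q b
b2q-nonNeg true  = <⇒≤ (positive⁻¹ 1ℚ)
b2q-nonNeg false = ≤-refl

x*x-nonNeg : ∀ x → 0ℚ ≤ x * x
x*x-nonNeg x with ≤-total 0ℚ x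
... | inj₁ 0≤x = subst (_≤ x * x) (*-zeroʳ x) (*-monoˡ-≤-nonNeg x {{ℚ.nonNegative 0≤x}} 0≤x)
... | inj₂ x≤0 = subst (_≤ x * x) (*-zeroʳ x) (*-monoˡ-≤-nonPos x {{ℚ.nonPositive x≤0}} x≤0)

x*x≡0⇒x≡0 : ∀ x → x * x ≡ 0ℚ → x ≡ 0ℚ
x*x≡0⇒x≡0 x x*x≡0 with x ℚ.≟ 0ℚ
... | yes x≡0 = x≡0
... | no x≢0  = ⊥-elim (x≢0 (begin
  x                     ≡⟨ sym (*-identityʳ x) ⟩
  x * 1ℚ                ≡⟨ cong (x *_) (sym (*-inverseʳ x)) ⟩
  x * (x * 1/x)         ≡⟨ sym (*-assoc x x 1/x) ⟩
  (x * x) * 1/x         ≡⟨ cong (_* 1/x) x*x≡0 ⟩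
  0ℚ * 1/x              ≡⟨ *-zeroˡ 1/x ⟩
  0ℚ                    ∎))
  where
  instance
    x-nonZero : ℚ.NonZero x
    x-nonZero = ℚ.≢-nonZero x≢0
  1/x : ℚ
  1/x = ℚ.1/ x

Σ-nonNeg : ∀ n (f : Fin n → ℚ) → (∀ i → 0ℚ ≤ f i) → 0ℚ ≤ Σ[ n ] f
Σ-nonNeg zero    f f≥0 = ≤-refl
Σ-nonNeg (suc n) f f≥0 =
  +-mono-≤ (f≥0 zero) (Σ-nonNeg n (λ i → f (suc i)) (λ i → f≥0 (suc i)))

term≤Σ : ∀ n (f : Fin n → ℚ) → (∀ i → 0ℚ ≤ f i) → ∀ k → f k ≤ Σ[ n ] f
term≤Σ (suc n) f f≥0 zero =
  subst (_≤ Σ[ suc n ] f) (+-identityʳ (f zero))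
        (+-monoʳ-≤ (f zero) (Σ-nonNeg n (λ i → f (suc i)) (λ i → f≥0 (suc i))))
term≤Σ (suc n) f f≥0 (suc k) =
  ≤-trans (term≤Σ n (λ i → f (suc i)) (λ i → f≥0 (suc i)) k)
          (subst (_≤ Σ[ suc n ] f) (+-identityˡ _) (+-monoˡ-≤ _ (f≥0 zero)))

Σ≡0⇒term≡0 : ∀ n (f : Fin n → ℚ) → (∀ i → 0ℚ ≤ f i) → Σ[ n ] f ≡ 0ℚ →
             ∀ k → f k ≡ 0ℚ
Σ≡0⇒term≡0 n f f≥0 Σf≡0 k =
  ≤-antisym (subst (f k ≤_) Σf≡0 (term≤Σ n f f≥0 k)) (f≥0 k)

-- Effective resistance through potentials

infixr 7 _*ᵥ_

_*ᵥ_ : ∀ {n} → Mat n → (Fin n → ℚ) → Fin n → ℚ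
_*ᵥ_ {n} M v a = Σ[ n ] (λ b → M a b * v b)

current : ∀ {n} → Fin n → Fin n → Fin n → ℚ
current i j a = δ i a - δ j a

⊗-*ᵥ : ∀ {n} (M N : Mat n) (v : Fin n → ℚ) a → (M *ᵥ N *ᵥ v) a ≡ ((M ⊗ N) *ᵥ v) a
⊗-*ᵥ {n} M N v a = begin
  Σ[ n ] (λ c → M a c * Σ[ n ] (λ b → N c b * v b))
    ≡⟨ Σ-cong n (λ c → trans (Σ-*ˡ n (M a c) _)
                             (Σ-cong n (λ b → sym (*-assoc (M a c) (N c b) (v b))))) ⟩
  Σ[ n ] (λ c → Σ[ n ] (λ b → (M a c * N c b) * v b))
    ≡⟨ Σ-swap n n _ ⟩
  Σ[ n ] (λ b → Σ[ n ] (λ c → (M a c * N c b) * v b))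
    ≡⟨ Σ-cong n (λ b → sym (Σ-*ʳ n (v b) _)) ⟩
  Σ[ n ] (λ b → (M ⊗ N) a b * v b) ∎

Σ-*-current : ∀ n (y : Fin n → ℚ) i j → Σ[ n ] (λ c → y c * current i j c) ≡ y i - y j
Σ-*-current n y i j = begin
  Σ[ n ] (λ c → y c * (δ i c - δ j c))
    ≡⟨ Σ-cong n (λ c → *-distribˡ-+ (y c) (δ i c) (- δ j c)) ⟩
  Σ[ n ] (λ c → y c * δ i c + y c * - δ j c)
    ≡⟨ Σ-+ n _ _ ⟩
  Σ[ n ] (λ c → y c * δ i c) + Σ[ n ] (λ c → y c * - δ j c)
    ≡⟨ cong (Σ[ n ] (λ c → y c * δ i c) +_)
            (trans (Σ-cong n (λ c → sym (neg-distribʳ-* (y c) (δ j c)))) (Σ-neg n _)) ⟩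
  Σ[ n ] (λ c → y c * δ i c) - Σ[ n ] (λ c → y c * δ j c)
    ≡⟨ cong₂ _-_ (Σ-δʳ n i y) (Σ-δʳ n j y) ⟩
  y i - y j ∎

resistance-sym : ∀ {n} (X : Mat n) i j → resistance X i j ≡ resistance X j i
resistance-sym {n} X i j =
  Σ-cong n (λ a → Σ-cong n (λ b → flip (δ i a) (δ j a) (X a b) (δ i b) (δ j b)))
  where
  flip : ∀ p q x r s → (p - q) * x * (r - s) ≡ (q - p) * x * (s - r)
  flip = solve 5 (λ p q x r s → (p :- q) :* x :* (r :- s) := (q :- p) :* x :* (s :- r)) refl

*ᵥ-self-adjoint : ∀ {n} (L : Mat n) → (∀ a b → L a b ≡ L b a) → ∀ (y u : Fin n → ℚ) →
                  Σ[ n ] (λ a → (L *ᵥ y) a * u a) ≡ Σ[ n ] (λ c → y c * (L *ᵥ u) c)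
*ᵥ-self-adjoint {n} L L-sym y u = begin
  Σ[ n ] (λ a → Σ[ n ] (λ c → L a c * y c) * u a)
    ≡⟨ Σ-cong n (λ a → Σ-*ʳ n (u a) _) ⟩
  Σ[ n ] (λ a → Σ[ n ] (λ c → L a c * y c * u a))
    ≡⟨ Σ-swap n n _ ⟩
  Σ[ n ] (λ c → Σ[ n ] (λ a → L a c * y c * u a))
    ≡⟨ Σ-cong n (λ c → Σ-cong n (λ a → reorder (L a c) (L c a) (y c) (u a) (L-sym a c))) ⟩
  Σ[ n ] (λ c → Σ[ n ] (λ a → y c * (L c a * u a)))
    ≡⟨ Σ-cong n (λ c → sym (Σ-*ˡ n (y c) _)) ⟩
  Σ[ n ] (λ c → y c * Σ[ n ] (λ a → L c a * u a)) ∎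
  where
  reorder : ∀ l l′ y u → l ≡ l′ → l * y * u ≡ y * (l′ * u)
  reorder l l′ y u refl = solve 3 (λ l y u → l :* y :* u := y :* (l :* u)) refl l y u

resistance-quadratic-form : ∀ {n} (X : Mat n) i j →
  resistance X i j ≡ Σ[ n ] (λ a → current i j a * (X *ᵥ current i j) a)
resistance-quadratic-form {n} X i j = Σ-cong n (λ a →
  trans (Σ-cong n (λ b → *-assoc (w a) (X a b) (w b))) (sym (Σ-*ˡ n (w a) _)))
  where w = current i j

-- With L y = e_i - e_j, the Penrose identity L X L = L gives r(i,j) = yᵀ L X L y = yᵀ L y.
resistance-by-potential : ∀ {n} (L X : Mat n) → (∀ a b → L a b ≡ L b a) → (L ⊗ X) ⊗ L ≡ L →
  ∀ i j (y : Fin n → ℚ) → (∀ a → (L *ᵥ y) a ≡ current i j a) → resistance X i j ≡ y i - y j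
resistance-by-potential {n} L X L-sym LXL≡L i j y Ly≡w = begin
  resistance X i j                     ≡⟨ resistance-quadratic-form X i j ⟩
  Σ[ n ] (λ a → w a * u a)             ≡⟨ Σ-cong n (λ a → cong (_* u a) (sym (Ly≡w a))) ⟩
  Σ[ n ] (λ a → (L *ᵥ y) a * u a)      ≡⟨ *ᵥ-self-adjoint L L-sym y u ⟩
  Σ[ n ] (λ c → y c * (L *ᵥ u) c)      ≡⟨ Σ-cong n (λ c → cong (y c *_) (Lu≡w c)) ⟩
  Σ[ n ] (λ c → y c * w c)             ≡⟨ Σ-*-current n y i j ⟩
  y i - y j                            ∎
  where
  w = current i j
  u = X *ᵥ w
  Lu≡w : ∀ c → (L *ᵥ u) c ≡ w c
  Lu≡w c = begin
    (L *ᵥ X *ᵥ w) c                 ≡⟨ ⊗-*ᵥ L X w c ⟩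
    ((L ⊗ X) *ᵥ w) c                ≡⟨ Σ-cong n (λ b → cong ((L ⊗ X) c b *_) (sym (Ly≡w b))) ⟩
    ((L ⊗ X) *ᵥ L *ᵥ y) c           ≡⟨ ⊗-*ᵥ (L ⊗ X) L y c ⟩
    (((L ⊗ X) ⊗ L) *ᵥ y) c          ≡⟨ cong (λ M → (M *ᵥ y) c) LXL≡L ⟩
    (L *ᵥ y) c                      ≡⟨ Ly≡w c ⟩
    w c                             ∎

-- Graph Laplacian and harmonic functions

IsSymmetric : ∀ {n} → Adj n → Set
IsSymmetric {n} A = ∀ i j → A i j ≡ A j i

laplace : ∀ {n} → Adj n → (Fin n → ℚ) → Fin n → ℚ
laplace {n} A y a = Σ[ n ] (λ b → b2q (A a b) * (y a - y b))

laplacian-*ᵥ : ∀ {n} (A : Adj n) y a → (laplacian A *ᵥ y) a ≡ laplace A y a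
laplacian-*ᵥ {n} A y a = begin
  Σ[ n ] (λ b → (δ a b * deg A a - b2q (A a b)) * y b)
    ≡⟨ Σ-cong n (λ b → expand (δ a b) (deg A a) (b2q (A a b)) (y b)) ⟩
  Σ[ n ] (λ b → δ a b * (deg A a * y b) - b2q (A a b) * y b)
    ≡⟨ Σ-sub n _ _ ⟩
  Σ[ n ] (λ b → δ a b * (deg A a * y b)) - Σ[ n ] (λ b → b2q (A a b) * y b)
    ≡⟨ cong (_- Σ[ n ] (λ b → b2q (A a b) * y b))
            (trans (Σ-δˡ n a (λ b → deg A a * y b)) (Σ-*ʳ n (y a) _)) ⟩
  Σ[ n ] (λ b → b2q (A a b) * y a) - Σ[ n ] (λ b → b2q (A a b) * y b)
    ≡⟨ sym (Σ-sub n _ _) ⟩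
  Σ[ n ] (λ b → b2q (A a b) * y a - b2q (A a b) * y b)
    ≡⟨ Σ-cong n (λ b → sym (*-distribˡ-sub (b2q (A a b)) (y a) (y b))) ⟩
  laplace A y a ∎
  where
  expand : ∀ d e a y → (d * e - a) * y ≡ d * (e * y) - a * y
  expand = solve 4 (λ d e a y → (d :* e :- a) :* y := d :* (e :* y) :- a :* y) refl
  *-distribˡ-sub : ∀ a x y → a * (x - y) ≡ a * x - a * y
  *-distribˡ-sub = solve 3 (λ a x y → a :* (x :- y) := a :* x :- a :* y) refl

laplacian-sym : ∀ {n} (A : Adj n) → IsSymmetric A → ∀ a b → laplacian A a b ≡ laplacian A b a
laplacian-sym A A-sym a b = by-cases (a ≟ b)
  where
  by-cases : Dec (a ≡ b) → laplacian A a b ≡ laplacian A b a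
  by-cases (yes refl) = refl
  by-cases (no a≢b)   = cong₂ _-_
    (trans (cong (_* deg A a) (δ-≢ a≢b)) (trans (*-zeroˡ (deg A a))
      (sym (trans (cong (_* deg A b) (δ-≢ (λ b≡a → a≢b (sym b≡a)))) (*-zeroˡ (deg A b))))))
    (cong b2q (A-sym a b))

laplace-const : ∀ {n} (A : Adj n) t a → laplace A (λ _ → t) a ≡ 0ℚ
laplace-const {n} A t a =
  Σ-≡0 n (λ b → trans (cong (b2q (A a b) *_) (+-inverseʳ t)) (*-zeroʳ (b2q (A a b))))

edgeEnergy : ∀ {n} → Adj n → (Fin n → ℚ) → Fin n → Fin n → ℚ
edgeEnergy A z a b = b2q (A a b) * (z a - z b) * (z a - z b)

edgeEnergy-nonNeg : ∀ {n} (A : Adj n) z a b → 0ℚ ≤ edgeEnergy A z a b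
edgeEnergy-nonNeg A z a b = subst (0ℚ ≤_) (sym (*-assoc (b2q (A a b)) d d))
  (subst (_≤ b2q (A a b) * (d * d)) (*-zeroˡ (d * d))
         (*-monoʳ-≤-nonNeg (d * d) {{ℚ.nonNegative (x*x-nonNeg d)}} (b2q-nonNeg (A a b))))
  where d = z a - z b

-- The energy equals 2 Σ_a z_a (Δz)_a: split (z_a − z_b) and use the symmetry of A on the z_b half.
harmonic⇒energy≡0 : ∀ {n} (A : Adj n) → IsSymmetric A → ∀ z → (∀ a → laplace A z a ≡ 0ℚ) →
                    Σ[ n ] (λ a → Σ[ n ] (edgeEnergy A z a)) ≡ 0ℚ
harmonic⇒energy≡0 {n} A A-sym z harmonic = begin
  Σ[ n ] (λ a → Σ[ n ] (λ b → flow a b * (z a - z b)))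
    ≡⟨ Σ-cong n (λ a → trans (Σ-cong n (λ b → *-distribˡ-+ (flow a b) (z a) (- z b)))
                             (Σ-+ n _ _)) ⟩
  Σ[ n ] (λ a → Σ[ n ] (λ b → flow a b * z a) + Σ[ n ] (λ b → flow a b * - z b))
    ≡⟨ Σ-+ n _ _ ⟩
  Σ[ n ] (λ a → Σ[ n ] (λ b → flow a b * z a))
    + Σ[ n ] (λ a → Σ[ n ] (λ b → flow a b * - z b))
    ≡⟨ cong₂ _+_ (Σ-≡0 n outgoing) (trans (Σ-swap n n _) (Σ-≡0 n incoming)) ⟩
  0ℚ + 0ℚ
    ≡⟨ +-identityˡ 0ℚ ⟩
  0ℚ ∎
  where
  flow : Fin n → Fin n → ℚ
  flow a b = b2q (A a b) * (z a - z b)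
  outgoing : ∀ a → Σ[ n ] (λ b → flow a b * z a) ≡ 0ℚ
  outgoing a = trans (sym (Σ-*ʳ n (z a) (flow a))) (trans (cong (_* z a) (harmonic a)) (*-zeroˡ (z a)))
  flow-antisym : ∀ a b → flow a b * - z b ≡ flow b a * z b
  flow-antisym a b = trans (cong (λ t → b2q t * (z a - z b) * - z b) (A-sym a b))
    (solve 3 (λ t x y → t :* (x :- y) :* (:- y) := t :* (y :- x) :* y) refl (b2q (A b a)) (z a) (z b))
  incoming : ∀ b → Σ[ n ] (λ a → flow a b * - z b) ≡ 0ℚ
  incoming b = trans (Σ-cong n (λ a → flow-antisym a b)) (outgoing b)

harmonic⇒constant : ∀ {n} (A : Adj n) → IsSymmetric A → Connected A →
                    ∀ z → (∀ a → laplace A z a ≡ 0ℚ) → ∀ i j → z i ≡ z j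
harmonic⇒constant {n} A A-sym connected z harmonic i j = along (connected i j)
  where
  energy≡0 : ∀ a b → edgeEnergy A z a b ≡ 0ℚ
  energy≡0 a = Σ≡0⇒term≡0 n (edgeEnergy A z a) (edgeEnergy-nonNeg A z a)
    (Σ≡0⇒term≡0 n (λ a → Σ[ n ] (edgeEnergy A z a))
                (λ a → Σ-nonNeg n _ (edgeEnergy-nonNeg A z a))
                (harmonic⇒energy≡0 A A-sym z harmonic) a)
  along-edge : ∀ a b → A a b ≡ true → z a ≡ z b
  along-edge a b edge = begin
    z a                 ≡⟨ solve 2 (λ x y → x := (x :- y) :+ y) refl (z a) (z b) ⟩
    (z a - z b) + z b   ≡⟨ cong (_+ z b) (x*x≡0⇒x≡0 (z a - z b) d*d≡0) ⟩
    0ℚ + z b            ≡⟨ +-identityˡ (z b) ⟩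
    z b                 ∎
    where
    d*d≡0 : (z a - z b) * (z a - z b) ≡ 0ℚ
    d*d≡0 = trans (cong (_* (z a - z b)) (sym (*-identityˡ (z a - z b))))
      (trans (cong (λ t → b2q t * (z a - z b) * (z a - z b)) (sym edge)) (energy≡0 a b))
  along : ∀ {j} → Reach A i j → z i ≡ z j
  along here          = refl
  along (step r edge) = trans (along r) (along-edge _ _ edge)

module Potential {n} (A : Adj n) (A-sym : IsSymmetric A) (connected : Connected A)
                 (X : Mat n) (X-pinv : IsPinv (laplacian A) X) where

  private
    L = laplacian A

    -- Q = I − LX is the orthogonal projection onto ker L, the constant vectors.
    Q : Mat n
    Q a b = δ a b - (L ⊗ X) a b

    Q-sym : ∀ a b → Q a b ≡ Q b a
    Q-sym a b = cong₂ _-_ (δ-sym a b) (sym (cong (λ M → M a b) (proj₁ (proj₂ (proj₂ X-pinv)))))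

    Q⊗L≡0 : ∀ a b → (Q ⊗ L) a b ≡ 0ℚ
    Q⊗L≡0 a b = begin
      Σ[ n ] (λ c → (δ a c - (L ⊗ X) a c) * L c b)
        ≡⟨ Σ-cong n (λ c → *-distribʳ-sub (L c b) (δ a c) ((L ⊗ X) a c)) ⟩
      Σ[ n ] (λ c → δ a c * L c b - (L ⊗ X) a c * L c b)
        ≡⟨ Σ-sub n _ _ ⟩
      Σ[ n ] (λ c → δ a c * L c b) - ((L ⊗ X) ⊗ L) a b
        ≡⟨ cong₂ _-_ (Σ-δˡ n a (λ c → L c b)) (cong (λ M → M a b) (proj₁ X-pinv)) ⟩
      L a b - L a b
        ≡⟨ +-inverseʳ (L a b) ⟩
      0ℚ ∎
      where
      *-distribʳ-sub : ∀ l x y → (x - y) * l ≡ x * l - y * l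
      *-distribʳ-sub = solve 3 (λ l x y → (x :- y) :* l := x :* l :- y :* l) refl

    Q-column-constant : ∀ a a′ b → Q a b ≡ Q a′ b
    Q-column-constant a a′ b = harmonic⇒constant A A-sym connected (λ c → Q c b) harmonic a a′
      where
      harmonic : ∀ c → laplace A (λ c → Q c b) c ≡ 0ℚ
      harmonic c = trans (sym (laplacian-*ᵥ A (λ c → Q c b) c))
        (trans (Σ-cong n (λ d → trans (cong₂ _*_ (laplacian-sym A A-sym c d) (Q-sym d b))
                                      (*-comm (L d c) (Q b d))))
               (Q⊗L≡0 b c))

    Q*current≡0 : ∀ i j a → (Q *ᵥ current i j) a ≡ 0ℚ
    Q*current≡0 i j a = begin
      (Q *ᵥ current i j) a  ≡⟨ Σ-*-current n (Q a) i j ⟩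
      Q a i - Q a j         ≡⟨ cong (λ t → Q a i - t) Q-aj≡Q-ai ⟩
      Q a i - Q a i         ≡⟨ +-inverseʳ (Q a i) ⟩
      0ℚ                    ∎
      where
      Q-aj≡Q-ai : Q a j ≡ Q a i
      Q-aj≡Q-ai = trans (Q-sym a j) (trans (Q-column-constant j i a) (Q-sym i a))

  potential : Fin n → Fin n → Fin n → ℚ
  potential i j = X *ᵥ current i j

  laplacian-potential : ∀ i j a → (L *ᵥ potential i j) a ≡ current i j a
  laplacian-potential i j a = begin
    (L *ᵥ X *ᵥ w) a
      ≡⟨ ⊗-*ᵥ L X w a ⟩
    Σ[ n ] (λ b → (L ⊗ X) a b * w b)
      ≡⟨ Σ-cong n (λ b → split (δ a b) ((L ⊗ X) a b) (w b)) ⟩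
    Σ[ n ] (λ b → δ a b * w b - Q a b * w b)
      ≡⟨ Σ-sub n _ _ ⟩
    Σ[ n ] (λ b → δ a b * w b) - (Q *ᵥ w) a
      ≡⟨ cong₂ _-_ (Σ-δˡ n a w) (Q*current≡0 i j a) ⟩
    w a - 0ℚ
      ≡⟨ +-identityʳ (w a) ⟩
    w a ∎
    where
    w = current i j
    split : ∀ d p w → p * w ≡ d * w - (d - p) * w
    split = solve 3 (λ d p w → p :* w := d :* w :- (d :- p) :* w) refl

  laplace-potential : ∀ i j a → laplace A (potential i j) a ≡ current i j a
  laplace-potential i j a = trans (sym (laplacian-*ᵥ A (potential i j) a)) (laplacian-potential i j a)

  resistance≡potential-drop : ∀ i j → resistance X i j ≡ potential i j i - potential i j j
  resistance≡potential-drop i j =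
    resistance-by-potential L X (laplacian-sym A A-sym) (proj₁ X-pinv)
                            i j (potential i j) (laplacian-potential i j)

-- Kemeny's constant as a degree-weighted resistance sum

degreeResistanceSum : ∀ {n} → Adj n → Mat n → ℚ
degreeResistanceSum {n} A X = Σ[ n ] (λ i → Σ[ n ] (λ j → deg A i * deg A j * resistance X i j))

degreeResistanceSum-by-moments : ∀ {n} (A : Adj n) X →
  degreeResistanceSum A X ≡ Σ[ n ] (λ j → deg A j * moment A X j)
degreeResistanceSum-by-moments {n} A X = trans (Σ-swap n n _) (Σ-cong n (λ j →
  trans (Σ-cong n (λ i → trans (cong (_* resistance X i j) (*-comm (deg A i) (deg A j)))
                               (*-assoc (deg A j) (deg A i) _)))
        (sym (Σ-*ˡ n (deg A j) _))))

Σdeg-pos : ∀ {n} (A : Adj n) → HasEdge A → ℚ.Positive (Σ[ n ] (deg A))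
Σdeg-pos {n} A (i , j , edge) =
  ℚ.positive (<-≤-trans (positive⁻¹ 1ℚ) (≤-trans 1≤deg (term≤Σ n (deg A) deg-nonNeg i)))
  where
  deg-nonNeg : ∀ i → 0ℚ ≤ deg A i
  deg-nonNeg i = Σ-nonNeg n (λ j → b2q (A i j)) (λ j → b2q-nonNeg (A i j))
  1≤deg : 1ℚ ≤ deg A i
  1≤deg = subst (_≤ deg A i) (cong b2q edge) (term≤Σ n (λ j → b2q (A i j)) (λ j → b2q-nonNeg (A i j)) j)

inv-inverseˡ : ∀ q → q ≢ 0ℚ → inv q * q ≡ 1ℚ
inv-inverseˡ q q≢0 with q ℚ.≟ 0ℚ
... | yes q≡0 = ⊥-elim (q≢0 q≡0)
... | no q≢0′ = *-inverseˡ q {{ℚ.≢-nonZero q≢0′}}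

inv-inverseʳ : ∀ q → q ≢ 0ℚ → q * inv q ≡ 1ℚ
inv-inverseʳ q q≢0 = trans (*-comm q (inv q)) (inv-inverseˡ q q≢0)

inv-cancelˡ : ∀ q x → q ≢ 0ℚ → inv q * (q * x) ≡ x
inv-cancelˡ q x q≢0 =
  trans (sym (*-assoc (inv q) q x)) (trans (cong (_* x) (inv-inverseˡ q q≢0)) (*-identityˡ x))

inv-cancelʳ : ∀ q x → q ≢ 0ℚ → q * (inv q * x) ≡ x
inv-cancelʳ q x q≢0 =
  trans (sym (*-assoc q (inv q) x)) (trans (cong (_* x) (inv-inverseʳ q q≢0)) (*-identityˡ x))

pos⇒≢0 : ∀ q → .{{ℚ.Positive q}} → q ≢ 0ℚ
pos⇒≢0 q q≡0 = <⇒≢ (positive⁻¹ q) (sym q≡0)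

four : ℚ
four = 1ℚ + 1ℚ + 1ℚ + 1ℚ

-- Dᵢ = 2mᵢ are degree sums, Sᵢ degree-weighted resistance sums (so K(Gᵢ) = Sᵢ / 4mᵢ), μᵢ moments at the cut.
kemeny-oneSum-algebra : ∀ D1 D2 S1 S2 μ1 μ2 → .{{ℚ.Positive D1}} → .{{ℚ.Positive D2}} →
  inv (four * (½ * D1 + ½ * D2)) * ((S1 + (D1 * μ2 + D2 * μ1)) + (S2 + (D2 * μ1 + D1 * μ2)))
  ≡ (½ * D1 * (inv (four * (½ * D1)) * S1 + μ2) + ½ * D2 * (inv (four * (½ * D2)) * S2 + μ1))
    * inv (½ * D1 + ½ * D2)
kemeny-oneSum-algebra D1 D2 S1 S2 μ1 μ2 = begin
  inv (four * m) * S                          ≡⟨ cong (inv (four * m) *_) S≡4m*[E/m] ⟩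
  inv (four * m) * (four * m * (E * inv m))   ≡⟨ inv-cancelˡ (four * m) (E * inv m) (pos⇒≢0 (four * m)) ⟩
  E * inv m                                   ∎
  where
  m1 = ½ * D1
  m2 = ½ * D2
  m  = m1 + m2
  instance
    m1-pos : ℚ.Positive m1
    m1-pos = pos*pos⇒pos ½ D1
    m2-pos : ℚ.Positive m2
    m2-pos = pos*pos⇒pos ½ D2
    m-pos : ℚ.Positive m
    m-pos = pos+pos⇒pos m1 m2
    4m1-pos : ℚ.Positive (four * m1)
    4m1-pos = pos*pos⇒pos four m1
    4m2-pos : ℚ.Positive (four * m2)
    4m2-pos = pos*pos⇒pos four m2
    4m-pos : ℚ.Positive (four * m)
    4m-pos = pos*pos⇒pos four m
  K1 = inv (four * m1) * S1
  K2 = inv (four * m2) * S2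
  E  = m1 * (K1 + μ2) + m2 * (K2 + μ1)
  S  = (S1 + (D1 * μ2 + D2 * μ1)) + (S2 + (D2 * μ1 + D1 * μ2))
  S≡4m*[E/m] : S ≡ four * m * (E * inv m)
  S≡4m*[E/m] = begin
    S
      ≡⟨ cong₂ (λ s t → (s + (D1 * μ2 + D2 * μ1)) + (t + (D2 * μ1 + D1 * μ2)))
               (sym (inv-cancelʳ (four * m1) S1 (pos⇒≢0 (four * m1))))
               (sym (inv-cancelʳ (four * m2) S2 (pos⇒≢0 (four * m2)))) ⟩
    (four * m1 * K1 + (D1 * μ2 + D2 * μ1)) + (four * m2 * K2 + (D2 * μ1 + D1 * μ2))
      ≡⟨ solve 6 (λ D1 D2 K1 K2 μ1 μ2 →
           (con four :* (con ½ :* D1) :* K1 :+ (D1 :* μ2 :+ D2 :* μ1))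
             :+ (con four :* (con ½ :* D2) :* K2 :+ (D2 :* μ1 :+ D1 :* μ2))
           := con four :* ((con ½ :* D1) :* (K1 :+ μ2) :+ (con ½ :* D2) :* (K2 :+ μ1)))
           refl D1 D2 K1 K2 μ1 μ2 ⟩
    four * E
      ≡⟨ sym (*-identityʳ (four * E)) ⟩
    four * E * 1ℚ
      ≡⟨ cong (four * E *_) (sym (inv-inverseʳ m (pos⇒≢0 m))) ⟩
    four * E * (m * inv m)
      ≡⟨ solve 4 (λ f e m i → f :* e :* (m :* i) := f :* m :* (e :* i)) refl four E m (inv m) ⟩
    four * m * (E * inv m) ∎

-- The 1-sum

module OneSum {n1 k2} (A1 : Adj n1) (A2 : Adj (suc k2)) (v1 : Fin n1) (v2 : Fin (suc k2)) where

  N : ℕ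
  N = n1 ℕ.+ k2

  G : Adj N
  G = oneSum A1 A2 v1 v2

  ι₁ : Fin n1 → Fin N
  ι₁ c = c ↑ˡ k2

  -- ρ p is the copy in G of the vertex punchIn v2 p ≢ v2 of G₂.
  ρ : Fin k2 → Fin N
  ρ p = n1 ↑ʳ p

  G-ι₁ι₁ : ∀ c c′ → G (ι₁ c) (ι₁ c′) ≡ A1 c c′
  G-ι₁ι₁ c c′ rewrite Finₚ.splitAt-↑ˡ n1 c k2 | Finₚ.splitAt-↑ˡ n1 c′ k2 = refl

  G-ι₁ρ : ∀ c q → G (ι₁ c) (ρ q) ≡ does (c ≟ v1) ∧ A2 v2 (punchIn v2 q)
  G-ι₁ρ c q rewrite Finₚ.splitAt-↑ˡ n1 c k2 | Finₚ.splitAt-↑ʳ n1 k2 q = refl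

  G-ρι₁ : ∀ p c → G (ρ p) (ι₁ c) ≡ does (c ≟ v1) ∧ A2 (punchIn v2 p) v2
  G-ρι₁ p c rewrite Finₚ.splitAt-↑ˡ n1 c k2 | Finₚ.splitAt-↑ʳ n1 k2 p = refl

  G-ρρ : ∀ p q → G (ρ p) (ρ q) ≡ A2 (punchIn v2 p) (punchIn v2 q)
  G-ρρ p q rewrite Finₚ.splitAt-↑ʳ n1 k2 p | Finₚ.splitAt-↑ʳ n1 k2 q = refl

  vertex-elim : ∀ (P : Fin N → Set) → (∀ c → P (ι₁ c)) → (∀ p → P (ρ p)) → ∀ x → P x
  vertex-elim P P-ι₁ P-ρ x = subst P (Finₚ.join-splitAt n1 k2 x) (by-side (splitAt n1 x))
    where
    by-side : (s : Fin n1 ⊎ Fin k2) → P (join n1 k2 s)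
    by-side (inj₁ c) = P-ι₁ c
    by-side (inj₂ p) = P-ρ p

  punchIn-elim : ∀ (P : Fin (suc k2) → Set) → P v2 → (∀ p → P (punchIn v2 p)) → ∀ a → P a
  punchIn-elim P P-v2 P-punchIn a with v2 ≟ a
  ... | yes refl = P-v2
  ... | no v2≢a  = subst P (Finₚ.punchIn-punchOut v2≢a) (P-punchIn (punchOut v2≢a))

  ι₂ : Fin (suc k2) → Fin N
  ι₂ a with v2 ≟ a
  ... | yes _   = ι₁ v1
  ... | no v2≢a = ρ (punchOut v2≢a)

  ι₂-v2 : ι₂ v2 ≡ ι₁ v1
  ι₂-v2 with v2 ≟ v2
  ... | yes _    = refl
  ... | no v2≢v2 = ⊥-elim (v2≢v2 refl)

  ι₂-punchIn : ∀ p → ι₂ (punchIn v2 p) ≡ ρ p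
  ι₂-punchIn p with v2 ≟ punchIn v2 p
  ... | yes v2≡ = ⊥-elim (Finₚ.punchInᵢ≢i v2 p (sym v2≡))
  ... | no v2≢  = cong ρ (trans (Finₚ.punchOut-cong v2 refl) (Finₚ.punchOut-punchIn v2))

  ι₁≢ρ : ∀ c p → ι₁ c ≢ ρ p
  ι₁≢ρ c p ι₁c≡ρp
    with trans (sym (Finₚ.splitAt-↑ˡ n1 c k2)) (trans (cong (splitAt n1) ι₁c≡ρp) (Finₚ.splitAt-↑ʳ n1 k2 p))
  ... | ()

  δ-ι₁ι₁ : ∀ i c → δ (ι₁ i) (ι₁ c) ≡ δ i c
  δ-ι₁ι₁ = δ-injective ι₁ (Finₚ.↑ˡ-injective k2)

  δ-ι₁ρ : ∀ i p → δ (ι₁ i) (ρ p) ≡ 0ℚ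
  δ-ι₁ρ i p = δ-≢ (ι₁≢ρ i p)

  δ-ι₂ι₁ : ∀ a c → δ (ι₂ a) (ι₁ c) ≡ δ c v1 * δ a v2
  δ-ι₂ι₁ a c = punchIn-elim (λ a → δ (ι₂ a) (ι₁ c) ≡ δ c v1 * δ a v2) at-v2 off-v2 a
    where
    at-v2 : δ (ι₂ v2) (ι₁ c) ≡ δ c v1 * δ v2 v2
    at-v2 = begin
      δ (ι₂ v2) (ι₁ c)   ≡⟨ cong (λ x → δ x (ι₁ c)) ι₂-v2 ⟩
      δ (ι₁ v1) (ι₁ c)   ≡⟨ trans (δ-ι₁ι₁ v1 c) (δ-sym v1 c) ⟩
      δ c v1             ≡⟨ sym (*-identityʳ (δ c v1)) ⟩
      δ c v1 * 1ℚ        ≡⟨ cong (δ c v1 *_) (sym (δ-refl v2)) ⟩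
      δ c v1 * δ v2 v2   ∎
    off-v2 : ∀ q → δ (ι₂ (punchIn v2 q)) (ι₁ c) ≡ δ c v1 * δ (punchIn v2 q) v2
    off-v2 q = begin
      δ (ι₂ (punchIn v2 q)) (ι₁ c)   ≡⟨ cong (λ x → δ x (ι₁ c)) (ι₂-punchIn q) ⟩
      δ (ρ q) (ι₁ c)                 ≡⟨ δ-≢ (λ ρq≡ι₁c → ι₁≢ρ c q (sym ρq≡ι₁c)) ⟩
      0ℚ                             ≡⟨ sym (*-zeroʳ (δ c v1)) ⟩
      δ c v1 * 0ℚ                    ≡⟨ cong (δ c v1 *_) (sym (δ-≢ (Finₚ.punchInᵢ≢i v2 q))) ⟩
      δ c v1 * δ (punchIn v2 q) v2   ∎

  δ-ι₂ρ : ∀ a p → δ (ι₂ a) (ρ p) ≡ δ a (punchIn v2 p)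
  δ-ι₂ρ a p = punchIn-elim (λ a → δ (ι₂ a) (ρ p) ≡ δ a (punchIn v2 p)) at-v2 off-v2 a
    where
    at-v2 : δ (ι₂ v2) (ρ p) ≡ δ v2 (punchIn v2 p)
    at-v2 = trans (cong (λ x → δ x (ρ p)) ι₂-v2)
      (trans (δ-ι₁ρ v1 p) (sym (δ-≢ (λ v2≡ → Finₚ.punchInᵢ≢i v2 p (sym v2≡)))))
    off-v2 : ∀ q → δ (ι₂ (punchIn v2 q)) (ρ p) ≡ δ (punchIn v2 q) (punchIn v2 p)
    off-v2 q = trans (cong (λ x → δ x (ρ p)) (ι₂-punchIn q))
      (trans (δ-injective ρ (Finₚ.↑ʳ-injective n1) q p)
             (sym (δ-injective (punchIn v2) (Finₚ.punchIn-injective v2) q p)))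

  G-sym : IsSymmetric A1 → IsSymmetric A2 → IsSymmetric G
  G-sym A1-sym A2-sym = vertex-elim _
    (λ c → vertex-elim _
      (λ c′ → trans (G-ι₁ι₁ c c′) (trans (A1-sym c c′) (sym (G-ι₁ι₁ c′ c))))
      (λ q → trans (G-ι₁ρ c q)
               (trans (cong (does (c ≟ v1) ∧_) (A2-sym v2 (punchIn v2 q))) (sym (G-ρι₁ q c)))))
    (λ p → vertex-elim _
      (λ c → trans (G-ρι₁ p c)
               (trans (cong (does (c ≟ v1) ∧_) (A2-sym (punchIn v2 p) v2)) (sym (G-ι₁ρ c p))))
      (λ q → trans (G-ρρ p q) (trans (A2-sym (punchIn v2 p) (punchIn v2 q)) (sym (G-ρρ q p)))))

  deg-ι₁ : A2 v2 v2 ≡ false → ∀ c → deg G (ι₁ c) ≡ deg A1 c + δ c v1 * deg A2 v2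
  deg-ι₁ A2-loopless c = begin
    deg G (ι₁ c)
      ≡⟨ Σ-↑ n1 k2 (λ y → b2q (G (ι₁ c) y)) ⟩
    Σ[ n1 ] (λ c′ → b2q (G (ι₁ c) (ι₁ c′))) + Σ[ k2 ] (λ q → b2q (G (ι₁ c) (ρ q)))
      ≡⟨ cong₂ _+_ (Σ-cong n1 (λ c′ → cong b2q (G-ι₁ι₁ c c′)))
                   (Σ-cong k2 (λ q → trans (cong b2q (G-ι₁ρ c q)) (b2q-∧ (does (c ≟ v1)) _))) ⟩
    deg A1 c + Σ[ k2 ] (λ q → δ c v1 * a2 q)
      ≡⟨ cong (deg A1 c +_) (trans (sym (Σ-*ˡ k2 (δ c v1) a2)) (cong (δ c v1 *_) (sym deg-v2))) ⟩
    deg A1 c + δ c v1 * deg A2 v2 ∎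
    where
    a2 : Fin k2 → ℚ
    a2 q = b2q (A2 v2 (punchIn v2 q))
    deg-v2 : deg A2 v2 ≡ Σ[ k2 ] a2
    deg-v2 = trans (Σ-punchIn k2 v2 (λ a → b2q (A2 v2 a)))
      (trans (cong (λ t → b2q t + Σ[ k2 ] a2) A2-loopless) (+-identityˡ (Σ[ k2 ] a2)))

  deg-ρ : ∀ p → deg G (ρ p) ≡ deg A2 (punchIn v2 p)
  deg-ρ p = begin
    deg G (ρ p)
      ≡⟨ Σ-↑ n1 k2 (λ y → b2q (G (ρ p) y)) ⟩
    Σ[ n1 ] (λ c → b2q (G (ρ p) (ι₁ c))) + Σ[ k2 ] (λ q → b2q (G (ρ p) (ρ q)))
      ≡⟨ cong₂ _+_ (Σ-cong n1 (λ c → trans (cong b2q (G-ρι₁ p c)) (b2q-∧ (does (c ≟ v1)) _)))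
                   (Σ-cong k2 (λ q → cong b2q (G-ρρ p q))) ⟩
    Σ[ n1 ] (λ c → δ c v1 * b2q (A2 (punchIn v2 p) v2)) + Σ[ k2 ] (λ q → a2 (punchIn v2 q))
      ≡⟨ cong (_+ Σ[ k2 ] (λ q → a2 (punchIn v2 q))) (Σ-δˡ′ n1 v1 (λ _ → a2 v2)) ⟩
    a2 v2 + Σ[ k2 ] (λ q → a2 (punchIn v2 q))
      ≡⟨ sym (Σ-punchIn k2 v2 a2) ⟩
    deg A2 (punchIn v2 p) ∎
    where
    a2 : Fin (suc k2) → ℚ
    a2 b = b2q (A2 (punchIn v2 p) b)

  -- The cut vertex carries degree deg A1 v1 + deg A2 v2, which splits its weight between both sides.
  Σ-deg-* : A2 v2 v2 ≡ false → ∀ (h : Fin N → ℚ) →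
    Σ[ N ] (λ x → deg G x * h x) ≡ Σ[ n1 ] (λ c → deg A1 c * h (ι₁ c)) + Σ[ suc k2 ] (λ a → deg A2 a * h (ι₂ a))
  Σ-deg-* A2-loopless h = begin
    Σ[ N ] (λ x → deg G x * h x)
      ≡⟨ Σ-↑ n1 k2 _ ⟩
    Σ[ n1 ] (λ c → deg G (ι₁ c) * h (ι₁ c)) + Σ[ k2 ] (λ p → deg G (ρ p) * h (ρ p))
      ≡⟨ cong₂ _+_ side₁ side₂ ⟩
    (w1 + w2 v2) + Σ[ k2 ] (λ p → w2 (punchIn v2 p))
      ≡⟨ +-assoc w1 (w2 v2) _ ⟩
    w1 + (w2 v2 + Σ[ k2 ] (λ p → w2 (punchIn v2 p)))
      ≡⟨ cong (w1 +_) (sym (Σ-punchIn k2 v2 w2)) ⟩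
    w1 + Σ[ suc k2 ] w2 ∎
    where
    w1 : ℚ
    w1 = Σ[ n1 ] (λ c → deg A1 c * h (ι₁ c))
    w2 : Fin (suc k2) → ℚ
    w2 a = deg A2 a * h (ι₂ a)
    expand : ∀ d e t h → (d + e * t) * h ≡ d * h + e * (t * h)
    expand = solve 4 (λ d e t h → (d :+ e :* t) :* h := d :* h :+ e :* (t :* h)) refl
    side₁ : Σ[ n1 ] (λ c → deg G (ι₁ c) * h (ι₁ c)) ≡ w1 + w2 v2
    side₁ = begin
      Σ[ n1 ] (λ c → deg G (ι₁ c) * h (ι₁ c))
        ≡⟨ Σ-cong n1 (λ c → trans (cong (_* h (ι₁ c)) (deg-ι₁ A2-loopless c))
                                  (expand (deg A1 c) (δ c v1) (deg A2 v2) (h (ι₁ c)))) ⟩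
      Σ[ n1 ] (λ c → deg A1 c * h (ι₁ c) + δ c v1 * (deg A2 v2 * h (ι₁ c)))
        ≡⟨ Σ-+ n1 _ _ ⟩
      w1 + Σ[ n1 ] (λ c → δ c v1 * (deg A2 v2 * h (ι₁ c)))
        ≡⟨ cong (w1 +_) (trans (Σ-δˡ′ n1 v1 (λ c → deg A2 v2 * h (ι₁ c)))
                               (cong (λ x → deg A2 v2 * h x) (sym ι₂-v2))) ⟩
      w1 + w2 v2 ∎
    side₂ : Σ[ k2 ] (λ p → deg G (ρ p) * h (ρ p)) ≡ Σ[ k2 ] (λ p → w2 (punchIn v2 p))
    side₂ = Σ-cong k2 (λ p → cong₂ _*_ (deg-ρ p) (cong h (sym (ι₂-punchIn p))))

  edges-oneSum : A2 v2 v2 ≡ false → edges G ≡ edges A1 + edges A2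
  edges-oneSum A2-loopless =
    trans (cong (½ *_) Σdeg-G) (*-distribˡ-+ ½ (Σ[ n1 ] (deg A1)) (Σ[ suc k2 ] (deg A2)))
    where
    Σdeg-G : Σ[ N ] (deg G) ≡ Σ[ n1 ] (deg A1) + Σ[ suc k2 ] (deg A2)
    Σdeg-G = trans (Σ-cong N (λ x → sym (*-identityʳ (deg G x))))
      (trans (Σ-deg-* A2-loopless (λ _ → 1ℚ))
             (cong₂ _+_ (Σ-cong n1 (λ c → *-identityʳ (deg A1 c)))
                        (Σ-cong (suc k2) (λ a → *-identityʳ (deg A2 a)))))

  -- Both potentials are grounded at the cut vertex, so they agree there.
  glue : (Fin n1 → ℚ) → (Fin (suc k2) → ℚ) → Fin N → ℚ
  glue y1 y2 x = [ (λ c → y1 c - y1 v1) , (λ p → y2 (punchIn v2 p) - y2 v2) ]′ (splitAt n1 x)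

  module _ (y1 : Fin n1 → ℚ) (y2 : Fin (suc k2) → ℚ) where

    private
      Y = glue y1 y2
      pI = punchIn v2

      drop-shift : ∀ x y t → (x - t) - (y - t) ≡ x - y
      drop-shift = solve 3 (λ x y t → (x :- t) :- (y :- t) := x :- y) refl

    glue-ι₁ : ∀ c → Y (ι₁ c) ≡ y1 c - y1 v1
    glue-ι₁ c rewrite Finₚ.splitAt-↑ˡ n1 c k2 = refl

    glue-ρ : ∀ p → Y (ρ p) ≡ y2 (pI p) - y2 v2
    glue-ρ p rewrite Finₚ.splitAt-↑ʳ n1 k2 p = refl

    glue-ι₂ : ∀ a → Y (ι₂ a) ≡ y2 a - y2 v2
    glue-ι₂ = punchIn-elim (λ a → Y (ι₂ a) ≡ y2 a - y2 v2)
      (trans (cong Y ι₂-v2) (trans (glue-ι₁ v1) (trans (+-inverseʳ (y1 v1)) (sym (+-inverseʳ (y2 v2))))))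
      (λ p → trans (cong Y (ι₂-punchIn p)) (glue-ρ p))

    private
      edge-ι₁ι₁ : ∀ c c′ → b2q (G (ι₁ c) (ι₁ c′)) * (Y (ι₁ c) - Y (ι₁ c′)) ≡ b2q (A1 c c′) * (y1 c - y1 c′)
      edge-ι₁ι₁ c c′ = cong₂ (λ g t → b2q g * t) (G-ι₁ι₁ c c′)
        (trans (cong₂ _-_ (glue-ι₁ c) (glue-ι₁ c′)) (drop-shift (y1 c) (y1 c′) (y1 v1)))

      edge-ρρ : ∀ p q → b2q (G (ρ p) (ρ q)) * (Y (ρ p) - Y (ρ q)) ≡ b2q (A2 (pI p) (pI q)) * (y2 (pI p) - y2 (pI q))
      edge-ρρ p q = cong₂ (λ g t → b2q g * t) (G-ρρ p q)
        (trans (cong₂ _-_ (glue-ρ p) (glue-ρ q)) (drop-shift (y2 (pI p)) (y2 (pI q)) (y2 v2)))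

      edge-ι₁ρ : ∀ c q → b2q (G (ι₁ c) (ρ q)) * (Y (ι₁ c) - Y (ρ q))
                         ≡ δ c v1 * (b2q (A2 v2 (pI q)) * (y2 v2 - y2 (pI q)))
      edge-ι₁ρ c q = begin
        b2q (G (ι₁ c) (ρ q)) * (Y (ι₁ c) - Y (ρ q))
          ≡⟨ cong₂ (λ g t → b2q g * t) (G-ι₁ρ c q) (cong₂ _-_ (glue-ι₁ c) (glue-ρ q)) ⟩
        b2q (does (c ≟ v1) ∧ a) * ((y1 c - y1 v1) - s)
          ≡⟨ trans (cong (_* ((y1 c - y1 v1) - s)) (b2q-∧ (does (c ≟ v1)) a)) (*-assoc (δ c v1) (b2q a) _) ⟩
        δ c v1 * (b2q a * ((y1 c - y1 v1) - s))
          ≡⟨ δ-*-cong c v1 (λ u → b2q a * ((u - y1 v1) - s)) (cong y1) ⟩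
        δ c v1 * (b2q a * ((y1 v1 - y1 v1) - s))
          ≡⟨ cong (λ t → δ c v1 * (b2q a * t))
                  (solve 3 (λ u x y → (u :- u) :- (y :- x) := x :- y) refl (y1 v1) (y2 v2) (y2 (pI q))) ⟩
        δ c v1 * (b2q a * (y2 v2 - y2 (pI q))) ∎
        where
        a = A2 v2 (pI q)
        s = y2 (pI q) - y2 v2

      edge-ρι₁ : ∀ p c → b2q (G (ρ p) (ι₁ c)) * (Y (ρ p) - Y (ι₁ c))
                         ≡ δ c v1 * (b2q (A2 (pI p) v2) * (y2 (pI p) - y2 v2))
      edge-ρι₁ p c = begin
        b2q (G (ρ p) (ι₁ c)) * (Y (ρ p) - Y (ι₁ c))
          ≡⟨ cong₂ (λ g t → b2q g * t) (G-ρι₁ p c) (cong₂ _-_ (glue-ρ p) (glue-ι₁ c)) ⟩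
        b2q (does (c ≟ v1) ∧ a) * (s - (y1 c - y1 v1))
          ≡⟨ trans (cong (_* (s - (y1 c - y1 v1))) (b2q-∧ (does (c ≟ v1)) a)) (*-assoc (δ c v1) (b2q a) _) ⟩
        δ c v1 * (b2q a * (s - (y1 c - y1 v1)))
          ≡⟨ δ-*-cong c v1 (λ u → b2q a * (s - (u - y1 v1))) (cong y1) ⟩
        δ c v1 * (b2q a * (s - (y1 v1 - y1 v1)))
          ≡⟨ cong (λ t → δ c v1 * (b2q a * t))
                  (solve 3 (λ u x y → (x :- y) :- (u :- u) := x :- y) refl (y1 v1) (y2 (pI p)) (y2 v2)) ⟩
        δ c v1 * (b2q a * (y2 (pI p) - y2 v2)) ∎
        where
        a = A2 (pI p) v2
        s = y2 (pI p) - y2 v2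

      laplace-v2 : laplace A2 y2 v2 ≡ Σ[ k2 ] (λ q → b2q (A2 v2 (pI q)) * (y2 v2 - y2 (pI q)))
      laplace-v2 = trans (Σ-punchIn k2 v2 (λ b → b2q (A2 v2 b) * (y2 v2 - y2 b)))
        (trans (cong (_+ Σ[ k2 ] (λ q → b2q (A2 v2 (pI q)) * (y2 v2 - y2 (pI q))))
                     (trans (cong (b2q (A2 v2 v2) *_) (+-inverseʳ (y2 v2))) (*-zeroʳ (b2q (A2 v2 v2)))))
               (+-identityˡ _))

    laplace-glue-ι₁ : ∀ c → laplace G Y (ι₁ c) ≡ laplace A1 y1 c + δ c v1 * laplace A2 y2 v2
    laplace-glue-ι₁ c = begin
      laplace G Y (ι₁ c)
        ≡⟨ Σ-↑ n1 k2 _ ⟩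
      Σ[ n1 ] (λ c′ → b2q (G (ι₁ c) (ι₁ c′)) * (Y (ι₁ c) - Y (ι₁ c′)))
        + Σ[ k2 ] (λ q → b2q (G (ι₁ c) (ρ q)) * (Y (ι₁ c) - Y (ρ q)))
        ≡⟨ cong₂ _+_ (Σ-cong n1 (edge-ι₁ι₁ c)) (Σ-cong k2 (edge-ι₁ρ c)) ⟩
      laplace A1 y1 c + Σ[ k2 ] (λ q → δ c v1 * (b2q (A2 v2 (pI q)) * (y2 v2 - y2 (pI q))))
        ≡⟨ cong (laplace A1 y1 c +_) (trans (sym (Σ-*ˡ k2 (δ c v1) _)) (cong (δ c v1 *_) (sym laplace-v2))) ⟩
      laplace A1 y1 c + δ c v1 * laplace A2 y2 v2 ∎

    laplace-glue-ρ : ∀ p → laplace G Y (ρ p) ≡ laplace A2 y2 (pI p)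
    laplace-glue-ρ p = begin
      laplace G Y (ρ p)
        ≡⟨ Σ-↑ n1 k2 _ ⟩
      Σ[ n1 ] (λ c → b2q (G (ρ p) (ι₁ c)) * (Y (ρ p) - Y (ι₁ c)))
        + Σ[ k2 ] (λ q → b2q (G (ρ p) (ρ q)) * (Y (ρ p) - Y (ρ q)))
        ≡⟨ cong₂ _+_ (trans (Σ-cong n1 (edge-ρι₁ p)) (Σ-δˡ′ n1 v1 _)) (Σ-cong k2 (edge-ρρ p)) ⟩
      b2q (A2 (pI p) v2) * (y2 (pI p) - y2 v2)
        + Σ[ k2 ] (λ q → b2q (A2 (pI p) (pI q)) * (y2 (pI p) - y2 (pI q)))
        ≡⟨ sym (Σ-punchIn k2 v2 (λ b → b2q (A2 (pI p) b) * (y2 (pI p) - y2 b))) ⟩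
      laplace A2 y2 (pI p) ∎

  module Resistance (A1-sym : IsSymmetric A1) (A2-sym : IsSymmetric A2)
                    (connected1 : Connected A1) (connected2 : Connected A2)
                    (X1 : Mat n1) (X2 : Mat (suc k2)) (X : Mat N)
                    (X1-pinv : IsPinv (laplacian A1) X1) (X2-pinv : IsPinv (laplacian A2) X2)
                    (X-pinv : IsPinv (laplacian G) X) where

    private
      module P1 = Potential A1 A1-sym connected1 X1 X1-pinv
      module P2 = Potential A2 A2-sym connected2 X2 X2-pinv
      pI = punchIn v2
      zero1 : Fin n1 → ℚ
      zero1 _ = 0ℚ
      zero2 : Fin (suc k2) → ℚ
      zero2 _ = 0ℚ

    resistance-glue : ∀ x x′ y1 y2 →
      (∀ c → laplace A1 y1 c + δ c v1 * laplace A2 y2 v2 ≡ current x x′ (ι₁ c)) →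
      (∀ p → laplace A2 y2 (pI p) ≡ current x x′ (ρ p)) →
      resistance X x x′ ≡ glue y1 y2 x - glue y1 y2 x′
    resistance-glue x x′ y1 y2 on-ι₁ on-ρ =
      resistance-by-potential (laplacian G) X (laplacian-sym G (G-sym A1-sym A2-sym)) (proj₁ X-pinv)
        x x′ (glue y1 y2) (λ a → trans (laplacian-*ᵥ G (glue y1 y2) a) (laplace-glue a))
      where
      laplace-glue : ∀ a → laplace G (glue y1 y2) a ≡ current x x′ a
      laplace-glue = vertex-elim _ (λ c → trans (laplace-glue-ι₁ y1 y2 c) (on-ι₁ c))
                                   (λ p → trans (laplace-glue-ρ y1 y2 p) (on-ρ p))

    resistance-ι₁ι₁ : ∀ i j → resistance X (ι₁ i) (ι₁ j) ≡ resistance X1 i j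
    resistance-ι₁ι₁ i j = begin
      resistance X (ι₁ i) (ι₁ j)
        ≡⟨ resistance-glue (ι₁ i) (ι₁ j) y1 zero2 on-ι₁ on-ρ ⟩
      glue y1 zero2 (ι₁ i) - glue y1 zero2 (ι₁ j)
        ≡⟨ cong₂ _-_ (glue-ι₁ y1 zero2 i) (glue-ι₁ y1 zero2 j) ⟩
      (y1 i - y1 v1) - (y1 j - y1 v1)
        ≡⟨ solve 3 (λ x y t → (x :- t) :- (y :- t) := x :- y) refl (y1 i) (y1 j) (y1 v1) ⟩
      y1 i - y1 j
        ≡⟨ sym (P1.resistance≡potential-drop i j) ⟩
      resistance X1 i j ∎
      where
      y1 = P1.potential i j
      on-ι₁ : ∀ c → laplace A1 y1 c + δ c v1 * laplace A2 zero2 v2 ≡ current (ι₁ i) (ι₁ j) (ι₁ c)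
      on-ι₁ c = begin
        laplace A1 y1 c + δ c v1 * laplace A2 zero2 v2
          ≡⟨ cong₂ (λ s t → s + δ c v1 * t) (P1.laplace-potential i j c) (laplace-const A2 0ℚ v2) ⟩
        current i j c + δ c v1 * 0ℚ
          ≡⟨ trans (cong (current i j c +_) (*-zeroʳ (δ c v1))) (+-identityʳ _) ⟩
        δ i c - δ j c
          ≡⟨ sym (cong₂ _-_ (δ-ι₁ι₁ i c) (δ-ι₁ι₁ j c)) ⟩
        current (ι₁ i) (ι₁ j) (ι₁ c) ∎
      on-ρ : ∀ p → laplace A2 zero2 (pI p) ≡ current (ι₁ i) (ι₁ j) (ρ p)
      on-ρ p = trans (laplace-const A2 0ℚ (pI p)) (sym (cong₂ _-_ (δ-ι₁ρ i p) (δ-ι₁ρ j p)))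

    resistance-ι₂ι₂ : ∀ a b → resistance X (ι₂ a) (ι₂ b) ≡ resistance X2 a b
    resistance-ι₂ι₂ a b = begin
      resistance X (ι₂ a) (ι₂ b)
        ≡⟨ resistance-glue (ι₂ a) (ι₂ b) zero1 y2 on-ι₁ on-ρ ⟩
      glue zero1 y2 (ι₂ a) - glue zero1 y2 (ι₂ b)
        ≡⟨ cong₂ _-_ (glue-ι₂ zero1 y2 a) (glue-ι₂ zero1 y2 b) ⟩
      (y2 a - y2 v2) - (y2 b - y2 v2)
        ≡⟨ solve 3 (λ x y t → (x :- t) :- (y :- t) := x :- y) refl (y2 a) (y2 b) (y2 v2) ⟩
      y2 a - y2 b
        ≡⟨ sym (P2.resistance≡potential-drop a b) ⟩
      resistance X2 a b ∎
      where
      y2 = P2.potential a b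
      on-ι₁ : ∀ c → laplace A1 zero1 c + δ c v1 * laplace A2 y2 v2 ≡ current (ι₂ a) (ι₂ b) (ι₁ c)
      on-ι₁ c = begin
        laplace A1 zero1 c + δ c v1 * laplace A2 y2 v2
          ≡⟨ cong₂ (λ s t → s + δ c v1 * t) (laplace-const A1 0ℚ c) (P2.laplace-potential a b v2) ⟩
        0ℚ + δ c v1 * (δ a v2 - δ b v2)
          ≡⟨ solve 3 (λ d x y → con 0ℚ :+ d :* (x :- y) := d :* x :- d :* y) refl (δ c v1) (δ a v2) (δ b v2) ⟩
        δ c v1 * δ a v2 - δ c v1 * δ b v2
          ≡⟨ sym (cong₂ _-_ (δ-ι₂ι₁ a c) (δ-ι₂ι₁ b c)) ⟩
        current (ι₂ a) (ι₂ b) (ι₁ c) ∎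
      on-ρ : ∀ p → laplace A2 y2 (pI p) ≡ current (ι₂ a) (ι₂ b) (ρ p)
      on-ρ p = trans (P2.laplace-potential a b (pI p)) (sym (cong₂ _-_ (δ-ι₂ρ a p) (δ-ι₂ρ b p)))

    resistance-ι₁ι₂ : ∀ i b → resistance X (ι₁ i) (ι₂ b) ≡ resistance X1 i v1 + resistance X2 v2 b
    resistance-ι₁ι₂ i b = begin
      resistance X (ι₁ i) (ι₂ b)
        ≡⟨ resistance-glue (ι₁ i) (ι₂ b) y1 y2 on-ι₁ on-ρ ⟩
      glue y1 y2 (ι₁ i) - glue y1 y2 (ι₂ b)
        ≡⟨ cong₂ _-_ (glue-ι₁ y1 y2 i) (glue-ι₂ y1 y2 b) ⟩
      (y1 i - y1 v1) - (y2 b - y2 v2)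
        ≡⟨ solve 4 (λ a b c d → (a :- b) :- (c :- d) := (a :- b) :+ (d :- c)) refl (y1 i) (y1 v1) (y2 b) (y2 v2) ⟩
      (y1 i - y1 v1) + (y2 v2 - y2 b)
        ≡⟨ sym (cong₂ _+_ (P1.resistance≡potential-drop i v1) (P2.resistance≡potential-drop v2 b)) ⟩
      resistance X1 i v1 + resistance X2 v2 b ∎
      where
      y1 = P1.potential i v1
      y2 = P2.potential v2 b
      on-ι₁ : ∀ c → laplace A1 y1 c + δ c v1 * laplace A2 y2 v2 ≡ current (ι₁ i) (ι₂ b) (ι₁ c)
      on-ι₁ c = begin
        laplace A1 y1 c + δ c v1 * laplace A2 y2 v2
          ≡⟨ cong₂ (λ s t → s + δ c v1 * t) (P1.laplace-potential i v1 c) (P2.laplace-potential v2 b v2) ⟩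
        (δ i c - δ v1 c) + δ c v1 * (δ v2 v2 - δ b v2)
          ≡⟨ cong₂ (λ s t → (δ i c - s) + δ c v1 * (t - δ b v2)) (δ-sym v1 c) (δ-refl v2) ⟩
        (δ i c - δ c v1) + δ c v1 * (1ℚ - δ b v2)
          ≡⟨ solve 3 (λ x d e → (x :- d) :+ d :* (con 1ℚ :- e) := x :- d :* e) refl (δ i c) (δ c v1) (δ b v2) ⟩
        δ i c - δ c v1 * δ b v2
          ≡⟨ sym (cong₂ _-_ (δ-ι₁ι₁ i c) (δ-ι₂ι₁ b c)) ⟩
        current (ι₁ i) (ι₂ b) (ι₁ c) ∎
      on-ρ : ∀ p → laplace A2 y2 (pI p) ≡ current (ι₁ i) (ι₂ b) (ρ p)
      on-ρ p = begin
        laplace A2 y2 (pI p)           ≡⟨ P2.laplace-potential v2 b (pI p) ⟩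
        δ v2 (pI p) - δ b (pI p)       ≡⟨ cong (_- δ b (pI p)) (δ-≢ (λ v2≡ → Finₚ.punchInᵢ≢i v2 p (sym v2≡))) ⟩
        0ℚ - δ b (pI p)                ≡⟨ sym (cong₂ _-_ (δ-ι₁ρ i p) (δ-ι₂ρ b p)) ⟩
        current (ι₁ i) (ι₂ b) (ρ p)    ∎

    private
      D1 = Σ[ n1 ] (deg A1)
      D2 = Σ[ suc k2 ] (deg A2)
      μ1 = moment A1 X1 v1
      μ2 = moment A2 X2 v2

    resistance-ι₂ι₁ : ∀ a c → resistance X (ι₂ a) (ι₁ c) ≡ resistance X2 a v2 + resistance X1 c v1
    resistance-ι₂ι₁ a c = begin
      resistance X (ι₂ a) (ι₁ c)                  ≡⟨ resistance-sym X (ι₂ a) (ι₁ c) ⟩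
      resistance X (ι₁ c) (ι₂ a)                  ≡⟨ resistance-ι₁ι₂ c a ⟩
      resistance X1 c v1 + resistance X2 v2 a     ≡⟨ +-comm (resistance X1 c v1) (resistance X2 v2 a) ⟩
      resistance X2 v2 a + resistance X1 c v1     ≡⟨ cong (_+ resistance X1 c v1) (resistance-sym X2 v2 a) ⟩
      resistance X2 a v2 + resistance X1 c v1     ∎

    module _ (A2-loopless : A2 v2 v2 ≡ false) where

      moment-ι₁ : ∀ c → moment G X (ι₁ c) ≡ moment A1 X1 c + (μ2 + D2 * resistance X1 c v1)
      moment-ι₁ c = begin
        moment G X (ι₁ c)
          ≡⟨ Σ-deg-* A2-loopless (λ x → resistance X x (ι₁ c)) ⟩
        Σ[ n1 ] (λ i → deg A1 i * resistance X (ι₁ i) (ι₁ c))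
          + Σ[ suc k2 ] (λ a → deg A2 a * resistance X (ι₂ a) (ι₁ c))
          ≡⟨ cong₂ _+_ (Σ-cong n1 (λ i → cong (deg A1 i *_) (resistance-ι₁ι₁ i c)))
                       (Σ-cong (suc k2) (λ a → cong (deg A2 a *_) (resistance-ι₂ι₁ a c))) ⟩
        moment A1 X1 c + Σ[ suc k2 ] (λ a → deg A2 a * (resistance X2 a v2 + resistance X1 c v1))
          ≡⟨ cong (moment A1 X1 c +_) (Σ-*-+ʳ (suc k2) (deg A2) (λ a → resistance X2 a v2) _) ⟩
        moment A1 X1 c + (μ2 + D2 * resistance X1 c v1) ∎

      moment-ι₂ : ∀ b → moment G X (ι₂ b) ≡ moment A2 X2 b + (μ1 + D1 * resistance X2 b v2)
      moment-ι₂ b = begin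
        moment G X (ι₂ b)
          ≡⟨ Σ-deg-* A2-loopless (λ x → resistance X x (ι₂ b)) ⟩
        Σ[ n1 ] (λ i → deg A1 i * resistance X (ι₁ i) (ι₂ b))
          + Σ[ suc k2 ] (λ a → deg A2 a * resistance X (ι₂ a) (ι₂ b))
          ≡⟨ cong₂ _+_ (Σ-cong n1 (λ i → cong (deg A1 i *_)
                         (trans (resistance-ι₁ι₂ i b) (cong (resistance X1 i v1 +_) (resistance-sym X2 v2 b)))))
                       (Σ-cong (suc k2) (λ a → cong (deg A2 a *_) (resistance-ι₂ι₂ a b))) ⟩
        Σ[ n1 ] (λ i → deg A1 i * (resistance X1 i v1 + resistance X2 b v2)) + moment A2 X2 b
          ≡⟨ cong (_+ moment A2 X2 b) (Σ-*-+ʳ n1 (deg A1) (λ i → resistance X1 i v1) _) ⟩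
        (μ1 + D1 * resistance X2 b v2) + moment A2 X2 b
          ≡⟨ +-comm (μ1 + D1 * resistance X2 b v2) (moment A2 X2 b) ⟩
        moment A2 X2 b + (μ1 + D1 * resistance X2 b v2) ∎

      degreeResistanceSum-oneSum : degreeResistanceSum G X
        ≡ (degreeResistanceSum A1 X1 + (D1 * μ2 + D2 * μ1))
          + (degreeResistanceSum A2 X2 + (D2 * μ1 + D1 * μ2))
      degreeResistanceSum-oneSum = begin
        degreeResistanceSum G X
          ≡⟨ degreeResistanceSum-by-moments G X ⟩
        Σ[ N ] (λ x → deg G x * moment G X x)
          ≡⟨ Σ-deg-* A2-loopless (moment G X) ⟩
        Σ[ n1 ] (λ c → deg A1 c * moment G X (ι₁ c)) + Σ[ suc k2 ] (λ b → deg A2 b * moment G X (ι₂ b))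
          ≡⟨ cong₂ _+_ (Σ-cong n1 (λ c → cong (deg A1 c *_) (moment-ι₁ c)))
                       (Σ-cong (suc k2) (λ b → cong (deg A2 b *_) (moment-ι₂ b))) ⟩
        Σ[ n1 ] (λ c → deg A1 c * (moment A1 X1 c + (μ2 + D2 * resistance X1 c v1)))
          + Σ[ suc k2 ] (λ b → deg A2 b * (moment A2 X2 b + (μ1 + D1 * resistance X2 b v2)))
          ≡⟨ cong₂ _+_ (Σ-*-affine n1 (deg A1) (moment A1 X1) (λ c → resistance X1 c v1) μ2 D2)
                       (Σ-*-affine (suc k2) (deg A2) (moment A2 X2) (λ b → resistance X2 b v2) μ1 D1) ⟩
        (Σ[ n1 ] (λ c → deg A1 c * moment A1 X1 c) + (D1 * μ2 + D2 * μ1))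
          + (Σ[ suc k2 ] (λ b → deg A2 b * moment A2 X2 b) + (D2 * μ1 + D1 * μ2))
          ≡⟨ sym (cong₂ (λ s t → (s + (D1 * μ2 + D2 * μ1)) + (t + (D2 * μ1 + D1 * μ2)))
                        (degreeResistanceSum-by-moments A1 X1) (degreeResistanceSum-by-moments A2 X2)) ⟩
        (degreeResistanceSum A1 X1 + (D1 * μ2 + D2 * μ1))
          + (degreeResistanceSum A2 X2 + (D2 * μ1 + D1 * μ2)) ∎

theorem2p1 : ∀ {n1 k2} (A1 : Adj n1) (A2 : Adj (suc k2)) (v1 : Fin n1) (v2 : Fin (suc k2))
    → Simple A1 → Simple A2 → Connected A1 → Connected A2 → HasEdge A1 → HasEdge A2
    → (X1 : Mat n1) (X2 : Mat (suc k2)) (X : Mat (n1 ℕ.+ k2))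
    → IsPinv (laplacian A1) X1 → IsPinv (laplacian A2) X2
    → IsPinv (laplacian (oneSum A1 A2 v1 v2)) X
    → kemeny (oneSum A1 A2 v1 v2) X
      ≡ (edges A1 * (kemeny A1 X1 + moment A2 X2 v2)
          + edges A2 * (kemeny A2 X2 + moment A1 X1 v1))
        * inv (edges A1 + edges A2)
theorem2p1 A1 A2 v1 v2 (A1-sym , _) (A2-sym , A2-loopless) connected1 connected2 A1-edge A2-edge
           X1 X2 X X1-pinv X2-pinv X-pinv =
  trans (cong₂ (λ m S → inv (four * m) * S) (edges-oneSum v2-loopless) (degreeResistanceSum-oneSum v2-loopless))
        (kemeny-oneSum-algebra D1 D2 (degreeResistanceSum A1 X1) (degreeResistanceSum A2 X2)
                               (moment A1 X1 v1) (moment A2 X2 v2))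
  where
  open OneSum A1 A2 v1 v2
  open Resistance A1-sym A2-sym connected1 connected2 X1 X2 X X1-pinv X2-pinv X-pinv
  v2-loopless = A2-loopless v2
  D1 = Σ[ _ ] (deg A1)
  D2 = Σ[ _ ] (deg A2)
  instance
    D1-pos : ℚ.Positive D1
    D1-pos = Σdeg-pos A1 A1-edge
    D2-pos : ℚ.Positive D2
    D2-pos = Σdeg-pos A2 A2-edge
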